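{- For any $\lambda\ge 1$ and $n\ge 1$, the minimum cost of a solution to the TBI problem on a path with $n$ nodes all having threshold $1$ is $\lceil n/(2\lambda+1)\rceil$.
   Context: TBI problem: given a graph $G=(V,E)$ with thresholds $t:V\to\{1,2,\dots\}$ and time bound $\lambda$, find an incentive function $p:V\to\{0,1,2,\dots\}$ with $p(v)\le t(v)$ of minimum cost $\sum_v p(v)$ such that $\mathsf{Influenced}[p,\lambda]=V$, where $\mathsf{Influenced}[p,0]=\{v:p(v)=t(v)\}$ and $\mathsf{Influenced}[p,\ell]=\mathsf{Influenced}[p,\ell-1]\cup\{v:|N(v)\cap\mathsf{Influenced}[p,\ell-1]|\ge t(v)-p(v)\}$ for $\ell>0$. -}

module Defs where

open import Data.Nat using (ℕ; zero; suc; _+_; _*_; _∸_; _≤_; _≡ᵇ_; _≤ᵇ_)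
open import Data.Nat.DivMod using (_/_)
open import Data.Bool using (Bool; true; false; _∧_; _∨_; if_then_else_)
open import Data.Fin using (Fin; toℕ)
open import Data.List using (List; map; allFin)
open import Data.Nat.ListAction using (sum)
open import Data.Product using (_×_; Σ; ∃; _,_)
open import Relation.Binary.PropositionalEquality using (_≡_)

record Graph (n : ℕ) : Set where
  field
    adj : Fin n → Fin n → Bool

open Graph public

path : (n : ℕ) → Graph n
path n = record { adj = λ i j → (suc (toℕ i) ≡ᵇ toℕ j) ∨ (suc (toℕ j) ≡ᵇ toℕ i) }

countNbrsIn : {n : ℕ} → Graph n → (Fin n → Bool) → Fin n → ℕ
countNbrsIn {n} G S v =
  sum (map (λ u → if adj G v u ∧ S u then 1 else 0) (allFin n))

Influenced : {n : ℕ} → Graph n → (t p : Fin n → ℕ) → ℕ → Fin n → Bool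
Influenced G t p zero v = p v ≡ᵇ t v
Influenced G t p (suc ℓ) v =
  Influenced G t p ℓ v ∨ (t v ∸ p v ≤ᵇ countNbrsIn G (Influenced G t p ℓ) v)

cost : {n : ℕ} → (Fin n → ℕ) → ℕ
cost {n} p = sum (map p (allFin n))

IsSolution : {n : ℕ} → Graph n → (t : Fin n → ℕ) → ℕ → (p : Fin n → ℕ) → Set
IsSolution G t λ' p =
  (∀ v → p v ≤ t v) × (∀ v → Influenced G t p λ' v ≡ true)

IsMinCost : {n : ℕ} → Graph n → (t : Fin n → ℕ) → ℕ → ℕ → Set
IsMinCost G t λ' c =
  Σ _ (λ p → IsSolution G t λ' p × cost p ≡ c)
  × (∀ p → IsSolution G t λ' p → c ≤ cost p)

-- ⌈ a / (b+1) ⌉ = (a + b) / (b+1)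
ceilDivSuc : ℕ → ℕ → ℕ
ceilDivSuc a b = (a + b) / suc b

-- With unit thresholds and p ≤ 1, influence travels one edge per round, so a vertex is
-- influenced by round λ exactly when it lies within distance λ of a vertex with p = 1.
-- Solutions are therefore sets of seeds whose radius-λ balls cover the path, and their
-- cost is the number of seeds. Cut the path from the top into blocks of 2λ + 1 vertices,
-- leaving a shorter block at the bottom. The top vertex of each block needs its own seed,
-- lying above every seed that serves the blocks below, which gives ⌈n / (2λ + 1)⌉ seeds at
-- least; a seed at the centre of each full block and one in the short block suffice.
module Submission where

open import Defs
open import Data.Nat using (ℕ; _≥_; _*_)
open import Data.Nat.Base
  using (zero; suc; _+_; _∸_; _≤_; _<_; _≡ᵇ_; _<ᵇ_; ∣_-_∣; z≤n; s≤s; s≤s⁻¹; z<s)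
open import Data.Nat.Properties
open import Data.Nat.DivMod using (_/_; m/n≡1+[m∸n]/n; m<n⇒m/n≡0)
open import Data.Nat.Induction using (<-rec)
open import Data.Nat.ListAction using (sum)
open import Data.Bool using (Bool; true; false; T; _∧_; _∨_; if_then_else_)
open import Data.Bool.Properties using (∨-zeroʳ; ∧-conicalˡ; ∧-conicalʳ; T-≡)
open import Data.Fin using (Fin; toℕ; fromℕ<; inject₁) renaming (zero to fzero; suc to fsuc)
open import Data.Fin.Properties using (toℕ-injective; toℕ<n; toℕ-fromℕ<; toℕ-inject₁)
open import Data.List using (List; _∷_; map; allFin; tabulate)
open import Data.List.Properties using (map-tabulate; map-cong)
open import Data.List.Membership.Propositional using (_∈_)
open import Data.List.Membership.Propositional.Properties using (∈-allFin)
open import Data.List.Relation.Unary.Any using (here; there)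
open import Data.Product using (Σ; ∃-syntax; _×_; _,_)
open import Data.Sum using (_⊎_; inj₁; inj₂)
open import Function using (_∘_)
open import Function.Bundles using (Equivalence)
open import Relation.Binary.PropositionalEquality
open import Relation.Binary.Definitions using (tri<; tri≈; tri>)
open import Relation.Nullary using (¬_; Dec; yes; no; contradiction)

T⇒≡true : ∀ {b} → T b → b ≡ true
T⇒≡true = Equivalence.to T-≡

≡true⇒T : ∀ {b} → b ≡ true → T b
≡true⇒T = Equivalence.from T-≡

∨≡true⇒ : ∀ a {b} → a ∨ b ≡ true → a ≡ true ⊎ b ≡ true
∨≡true⇒ true  _ = inj₁ refl
∨≡true⇒ false e = inj₂ e

∨-trueˡ : ∀ {a b} → a ≡ true → a ∨ b ≡ true
∨-trueˡ refl = refl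

∨-trueʳ : ∀ {a b} → b ≡ true → a ∨ b ≡ true
∨-trueʳ {a} refl = ∨-zeroʳ a

≡ᵇ-refl : ∀ m → (m ≡ᵇ m) ≡ true
≡ᵇ-refl m = T⇒≡true (≡⇒≡ᵇ m m refl)

≢⇒≡ᵇ-false : ∀ {m n} → ¬ m ≡ n → (m ≡ᵇ n) ≡ false
≢⇒≡ᵇ-false {m} {n} m≢n with m ≡ᵇ n in eq
... | true  = contradiction (≡ᵇ⇒≡ m n (≡true⇒T eq)) m≢n
... | false = refl

indicator : Bool → ℕ
indicator b = if b then 1 else 0

indicator≤1 : ∀ b → indicator b ≤ 1
indicator≤1 true  = ≤-refl
indicator≤1 false = z≤n

sumBelow : ℕ → (ℕ → ℕ) → ℕ
sumBelow zero    f = 0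
sumBelow (suc m) f = sumBelow m f + f m

sumBelow-+ : ∀ m k (f : ℕ → ℕ) →
  sumBelow (m + k) f ≡ sumBelow m f + sumBelow k (λ j → f (m + j))
sumBelow-+ m zero    f rewrite +-identityʳ m = sym (+-identityʳ _)
sumBelow-+ m (suc k) f rewrite +-suc m k | sumBelow-+ m k f =
  +-assoc (sumBelow m f) _ (f (m + k))

sumBelow-cong : ∀ m {f g : ℕ → ℕ} →
  (∀ i → i < m → f i ≡ g i) → sumBelow m f ≡ sumBelow m g
sumBelow-cong zero    f≡g = refl
sumBelow-cong (suc m) f≡g =
  cong₂ _+_ (sumBelow-cong m (λ i i<m → f≡g i (m<n⇒m<1+n i<m))) (f≡g m ≤-refl)

sumBelow-zero : ∀ m {f : ℕ → ℕ} → (∀ i → i < m → f i ≡ 0) → sumBelow m f ≡ 0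
sumBelow-zero zero    f≡0 = refl
sumBelow-zero (suc m) f≡0 =
  cong₂ _+_ (sumBelow-zero m (λ i i<m → f≡0 i (m<n⇒m<1+n i<m))) (f≡0 m ≤-refl)

sumBelow-mono : ∀ {a b} (f : ℕ → ℕ) → a ≤ b → sumBelow a f ≤ sumBelow b f
sumBelow-mono {a} {b} f a≤b = begin
  sumBelow a f                                       ≤⟨ m≤m+n _ _ ⟩
  sumBelow a f + sumBelow (b ∸ a) (λ j → f (a + j)) ≡⟨ sumBelow-+ a (b ∸ a) f ⟨
  sumBelow (a + (b ∸ a)) f                           ≡⟨ cong (λ c → sumBelow c f) (m+[n∸m]≡n a≤b) ⟩
  sumBelow b f                                       ∎
  where open ≤-Reasoning

sumBelow-+term-≤ : ∀ {a s b} (f : ℕ → ℕ) →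
  a ≤ s → s < b → sumBelow a f + f s ≤ sumBelow b f
sumBelow-+term-≤ f a≤s s<b =
  ≤-trans (+-monoˡ-≤ _ (sumBelow-mono f a≤s)) (sumBelow-mono f s<b)

sumBelow-indicator-≡ᵇ : ∀ s m → s < m → sumBelow m (λ i → indicator (i ≡ᵇ s)) ≡ 1
sumBelow-indicator-≡ᵇ s (suc m) s<1+m with m≤n⇒m<n∨m≡n (s≤s⁻¹ s<1+m)
... | inj₁ s<m  = cong₂ _+_ (sumBelow-indicator-≡ᵇ s m s<m)
                            (cong indicator (≢⇒≡ᵇ-false (<⇒≢ s<m ∘ sym)))
... | inj₂ refl = cong₂ _+_ (sumBelow-zero s (λ i i<s → cong indicator (≢⇒≡ᵇ-false (<⇒≢ i<s))))
                            (cong indicator (≡ᵇ-refl s))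

indicatorSum-pos⇒∃ : ∀ {A : Set} (b : A → Bool) (xs : List A) →
  1 ≤ sum (map (λ x → indicator (b x)) xs) → Σ A (λ x → b x ≡ true)
indicatorSum-pos⇒∃ b (x ∷ xs) pos with b x in bx
... | true  = x , bx
... | false = indicatorSum-pos⇒∃ b xs pos

∈⇒indicatorSum-pos : ∀ {A : Set} (b : A → Bool) {xs : List A} {x : A} →
  x ∈ xs → b x ≡ true → 1 ≤ sum (map (λ x → indicator (b x)) xs)
∈⇒indicatorSum-pos b (here refl)  bx rewrite bx = s≤s z≤n
∈⇒indicatorSum-pos b (there x∈xs) bx =
  ≤-trans (∈⇒indicatorSum-pos b x∈xs bx) (m≤n+m _ _)

ceilDivSuc-zero : ∀ d → ceilDivSuc 0 d ≡ 0
ceilDivSuc-zero d = m<n⇒m/n≡0 (n<1+n d)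

ceilDivSuc-suc : ∀ k d → ceilDivSuc (suc k) d ≡ suc (k / suc d)
ceilDivSuc-suc k d = begin
  suc (k + d) / suc d               ≡⟨ cong (_/ suc d) (+-suc k d) ⟨
  (k + suc d) / suc d               ≡⟨ m/n≡1+[m∸n]/n (m≤n+m (suc d) k) ⟩
  suc ((k + suc d ∸ suc d) / suc d) ≡⟨ cong (λ x → suc (x / suc d)) (m+n∸n≡m k (suc d)) ⟩
  suc (k / suc d)                   ∎
  where open ≡-Reasoning

ceilDivSuc-small : ∀ {k d} → k ≤ d → ceilDivSuc (suc k) d ≡ 1
ceilDivSuc-small {k} {d} k≤d = trans (ceilDivSuc-suc k d) (cong suc (m<n⇒m/n≡0 (s≤s k≤d)))

ceilDivSuc-+ : ∀ m d → ceilDivSuc (m + suc d) d ≡ suc (ceilDivSuc m d)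
ceilDivSuc-+ m d = trans (cong (λ x → ceilDivSuc x d) (+-suc m d)) (ceilDivSuc-suc (m + d) d)

blockInduction : ∀ {ℓ} (P : ℕ → Set ℓ) d →
  (∀ m → m ≤ d → P m) → (∀ m → P m → P (m + suc d)) → ∀ m → P m
blockInduction P d base step = <-rec P go
  where
  go : ∀ m → (∀ {k} → k < m → P k) → P m
  go m rec with m ≤? d
  ... | yes m≤d = base m m≤d
  ... | no  m≰d = subst P (m∸n+n≡m (≰⇒> m≰d))
                    (step (m ∸ suc d) (rec (∸-monoʳ-< {m} {suc d} {0} z<s (≰⇒> m≰d))))

2*m≡m+m : ∀ m → 2 * m ≡ m + m
2*m≡m+m m = cong (m +_) (+-identityʳ m)

∣m-n∣≤m : ∀ m n → n ≤ 2 * m → ∣ m - n ∣ ≤ m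
∣m-n∣≤m m n n≤2m with ∣m-n∣≡[m∸n]∨[n∸m] m n
... | inj₁ eq = ≤-trans (≤-reflexive eq) (m∸n≤m m n)
... | inj₂ eq = ≤-trans (≤-reflexive eq)
                  (m≤n+o⇒m∸n≤o n m (≤-trans n≤2m (≤-reflexive (2*m≡m+m m))))

∣m-n∣≤o⇒m≤n+o : ∀ {m n o} → ∣ m - n ∣ ≤ o → m ≤ n + o
∣m-n∣≤o⇒m≤n+o {m} {n} h = ≤-trans (m≤n+∣m-n∣ m n) (+-monoʳ-≤ n h)

∣m-[n+o]∣≤o⇒n≤m : ∀ {m n o} → ∣ m - (n + o) ∣ ≤ o → n ≤ m
∣m-[n+o]∣≤o⇒n≤m {m} {n} {o} h =
  +-cancelʳ-≤ o n m (∣m-n∣≤o⇒m≤n+o (subst (_≤ o) (∣-∣-comm m (n + o)) h))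

∣n-1+n∣≡1 : ∀ n → ∣ n - suc n ∣ ≡ 1
∣n-1+n∣≡1 zero    = refl
∣n-1+n∣≡1 (suc n) = ∣n-1+n∣≡1 n

m<n⇒∣m-n∣≡1+∣1+m-n∣ : ∀ {m n} → m < n → ∣ m - n ∣ ≡ suc ∣ suc m - n ∣
m<n⇒∣m-n∣≡1+∣1+m-n∣ {zero}  {suc n} _         = refl
m<n⇒∣m-n∣≡1+∣1+m-n∣ {suc m} {suc n} (s≤s m<n) = m<n⇒∣m-n∣≡1+∣1+m-n∣ m<n

-- Influence in an arbitrary graph

module _ {n : ℕ} (G : Graph n) where

  countNbrsIn-pos⇒neighbour : ∀ {S v} → 1 ≤ countNbrsIn G S v →
    Σ (Fin n) λ w → adj G v w ≡ true × S w ≡ true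
  countNbrsIn-pos⇒neighbour pos with indicatorSum-pos⇒∃ _ (allFin n) pos
  ... | w , e = w , ∧-conicalˡ _ _ e , ∧-conicalʳ _ _ e

  neighbour⇒countNbrsIn-pos : ∀ {S v w} →
    adj G v w ≡ true → S w ≡ true → 1 ≤ countNbrsIn G S v
  neighbour⇒countNbrsIn-pos {S} {v} {w} vw Sw =
    ∈⇒indicatorSum-pos (λ u → adj G v u ∧ S u) (∈-allFin w) (cong₂ _∧_ vw Sw)

  module _ (t p : Fin n → ℕ) where

    Influenced-mono : ∀ {ℓ ℓ′ v} → ℓ ≤ ℓ′ →
      Influenced G t p ℓ v ≡ true → Influenced G t p ℓ′ v ≡ true
    Influenced-mono {ℓ} {ℓ′} {v} ℓ≤ℓ′ inf =
      subst (λ k → Influenced G t p k v ≡ true) (m∸n+n≡m ℓ≤ℓ′) (go (ℓ′ ∸ ℓ))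
      where
      go : ∀ k → Influenced G t p (k + ℓ) v ≡ true
      go zero    = inf
      go (suc k) = ∨-trueˡ (go k)

    Influenced-spread : ∀ {ℓ v w} → t v ∸ p v ≤ 1 → adj G v w ≡ true →
      Influenced G t p ℓ w ≡ true → Influenced G t p (suc ℓ) v ≡ true
    Influenced-spread gap≤1 vw inf =
      ∨-trueʳ (T⇒≡true (≤⇒≤ᵇ (≤-trans gap≤1 (neighbour⇒countNbrsIn-pos vw inf))))

-- Influence on the path with unit thresholds

path-adj : ∀ {n} {v w : Fin n} →
  suc (toℕ v) ≡ toℕ w ⊎ suc (toℕ w) ≡ toℕ v → adj (path n) v w ≡ true
path-adj (inj₁ v+1≡w) = ∨-trueˡ (T⇒≡true (≡⇒≡ᵇ _ _ v+1≡w))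
path-adj (inj₂ w+1≡v) = ∨-trueʳ (T⇒≡true (≡⇒≡ᵇ _ _ w+1≡v))

path-adj⇒∣-∣≡1 : ∀ {n} {v w : Fin n} → adj (path n) v w ≡ true → ∣ toℕ v - toℕ w ∣ ≡ 1
path-adj⇒∣-∣≡1 {v = v} {w} vw with ∨≡true⇒ (suc (toℕ v) ≡ᵇ toℕ w) vw
... | inj₁ e = subst (λ x → ∣ toℕ v - x ∣ ≡ 1)
                 (≡ᵇ⇒≡ (suc (toℕ v)) (toℕ w) (≡true⇒T e)) (∣n-1+n∣≡1 (toℕ v))
... | inj₂ e = subst (λ x → ∣ x - toℕ w ∣ ≡ 1)
                 (≡ᵇ⇒≡ (suc (toℕ w)) (toℕ v) (≡true⇒T e))
                 (trans (∣-∣-comm (suc (toℕ w)) (toℕ w)) (∣n-1+n∣≡1 (toℕ w)))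

path-stepDown : ∀ {n} (u v : Fin n) → toℕ u < toℕ v →
  Σ (Fin n) λ w → adj (path n) v w ≡ true × suc ∣ toℕ u - toℕ w ∣ ≡ ∣ toℕ u - toℕ v ∣
path-stepDown u fzero    ()
path-stepDown u (fsuc i) u<v =
  inject₁ i , path-adj (inj₂ (cong suc (toℕ-inject₁ i))) ,
  trans (cong (λ x → suc ∣ toℕ u - x ∣) (toℕ-inject₁ i)) (sym (m<n⇒∣m-n∣≡1+∣1+m-n∣ u<v))

path-stepUp : ∀ {n} (u v : Fin n) → toℕ v < toℕ u →
  Σ (Fin n) λ w → adj (path n) v w ≡ true × suc ∣ toℕ u - toℕ w ∣ ≡ ∣ toℕ u - toℕ v ∣
path-stepUp u v v<u = w , path-adj (inj₁ (sym w≡v+1)) , (begin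
  suc ∣ toℕ u - toℕ w ∣       ≡⟨ cong (λ x → suc ∣ toℕ u - x ∣) w≡v+1 ⟩
  suc ∣ toℕ u - suc (toℕ v) ∣ ≡⟨ cong suc (∣-∣-comm (toℕ u) (suc (toℕ v))) ⟩
  suc ∣ suc (toℕ v) - toℕ u ∣ ≡⟨ m<n⇒∣m-n∣≡1+∣1+m-n∣ v<u ⟨
  ∣ toℕ v - toℕ u ∣           ≡⟨ ∣-∣-comm (toℕ v) (toℕ u) ⟩
  ∣ toℕ u - toℕ v ∣           ∎)
  where
  open ≡-Reasoning
  w = fromℕ< (≤-<-trans v<u (toℕ<n u))
  w≡v+1 : toℕ w ≡ suc (toℕ v)
  w≡v+1 = toℕ-fromℕ< _

path-neighbourTowards : ∀ {n k} (u v : Fin n) → ∣ toℕ u - toℕ v ∣ ≡ suc k →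
  Σ (Fin n) λ w → adj (path n) v w ≡ true × ∣ toℕ u - toℕ w ∣ ≡ k
path-neighbourTowards u v dist with <-cmp (toℕ u) (toℕ v)
... | tri≈ _ u≡v _ = contradiction (trans (sym (m≡n⇒∣m-n∣≡0 u≡v)) dist) λ ()
... | tri< u<v _ _ with path-stepDown u v u<v
...   | w , vw , closer = w , vw , suc-injective (trans closer dist)
path-neighbourTowards u v dist | tri> _ _ v<u with path-stepUp u v v<u
...   | w , vw , closer = w , vw , suc-injective (trans closer dist)

module _ {n : ℕ} (p : Fin n → ℕ) where

  private
    Inf : ℕ → Fin n → Bool
    Inf = Influenced (path n) (λ _ → 1) p

  influenced-at-distance : ∀ {u} → p u ≡ 1 →
    ∀ k v → ∣ toℕ u - toℕ v ∣ ≡ k → Inf k v ≡ true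
  influenced-at-distance pu zero v dist =
    subst (λ x → Inf 0 x ≡ true) (toℕ-injective (∣m-n∣≡0⇒m≡n dist)) (cong (_≡ᵇ 1) pu)
  influenced-at-distance {u} pu (suc k) v dist with path-neighbourTowards u v dist
  ... | w , vw , dist′ =
    Influenced-spread (path n) (λ _ → 1) p {k} (m∸n≤m 1 (p v)) vw
      (influenced-at-distance pu k w dist′)

  seed-within⇒influenced : ∀ {u ℓ v} → p u ≡ 1 →
    ∣ toℕ u - toℕ v ∣ ≤ ℓ → Inf ℓ v ≡ true
  seed-within⇒influenced pu dist≤ℓ =
    Influenced-mono (path n) (λ _ → 1) p dist≤ℓ (influenced-at-distance pu _ _ refl)

  influenced⇒seed-within : (∀ v → p v ≤ 1) → ∀ ℓ v → Inf ℓ v ≡ true →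
    Σ (Fin n) λ u → p u ≡ 1 × ∣ toℕ u - toℕ v ∣ ≤ ℓ
  influenced⇒seed-within p≤1 zero v seed =
    v , ≡ᵇ⇒≡ (p v) 1 (≡true⇒T seed) , ≤-reflexive (∣n-n∣≡0 (toℕ v))
  influenced⇒seed-within p≤1 (suc ℓ) v inf with ∨≡true⇒ (Inf ℓ v) inf
  ... | inj₁ inf′ with influenced⇒seed-within p≤1 ℓ v inf′
  ...   | u , pu , dist = u , pu , m≤n⇒m≤1+n dist
  influenced⇒seed-within p≤1 (suc ℓ) v inf | inj₂ gap≤count
    with 1 ≤? countNbrsIn (path n) (Inf ℓ) v
  ... | yes pos with countNbrsIn-pos⇒neighbour (path n) pos
  ...   | w , vw , inf′ with influenced⇒seed-within p≤1 ℓ w inf′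
  ...     | u , pu , dist = u , pu , (begin
    ∣ toℕ u - toℕ v ∣                     ≤⟨ ∣-∣-triangle (toℕ u) (toℕ w) (toℕ v) ⟩
    ∣ toℕ u - toℕ w ∣ + ∣ toℕ w - toℕ v ∣ ≤⟨ +-mono-≤ dist (≤-reflexive w~v) ⟩
    ℓ + 1                                 ≡⟨ +-comm ℓ 1 ⟩
    suc ℓ                                 ∎)
    where
    open ≤-Reasoning
    w~v : ∣ toℕ w - toℕ v ∣ ≡ 1
    w~v = trans (∣-∣-comm (toℕ w) (toℕ v)) (path-adj⇒∣-∣≡1 {v = v} {w} vw)
  influenced⇒seed-within p≤1 (suc ℓ) v inf | inj₂ gap≤count | no ¬pos =
    v , ≤-antisym (p≤1 v) (m∸n≡0⇒m≤n (n≤0⇒n≡0 gap≤0)) ,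
    ≤-trans (≤-reflexive (∣n-n∣≡0 (toℕ v))) z≤n
    where
    gap≤0 : 1 ∸ p v ≤ 0
    gap≤0 = ≤-trans (≤ᵇ⇒≤ _ _ (≡true⇒T gap≤count)) (s≤s⁻¹ (≰⇒> ¬pos))

-- Covering an initial segment of ℕ by balls of radius l

Dominates : ℕ → (ℕ → Set) → ℕ → Set
Dominates l S m = ∀ i → i < m → ∃[ s ] (S s × ∣ s - i ∣ ≤ l)

ceilDivSuc≤dominating-weight : ∀ l (e : ℕ → ℕ) m →
  Dominates l (λ s → 1 ≤ e s) m → ceilDivSuc m (2 * l) ≤ sumBelow (m + l) e
ceilDivSuc≤dominating-weight l e = blockInduction P d base step
  where
  d = 2 * l
  P : ℕ → Set
  P m = Dominates l (λ s → 1 ≤ e s) m → ceilDivSuc m d ≤ sumBelow (m + l) e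

  base : ∀ m → m ≤ d → P m
  base zero    _   _   = ≤-trans (≤-reflexive (ceilDivSuc-zero d)) z≤n
  base (suc k) k<d dom with dom 0 z<s
  ... | s , es , dist = begin
    ceilDivSuc (suc k) d   ≡⟨ ceilDivSuc-small (<⇒≤ k<d) ⟩
    1                      ≤⟨ es ⟩
    sumBelow 0 e + e s     ≤⟨ sumBelow-+term-≤ e z≤n s<k+1+l ⟩
    sumBelow (suc k + l) e ∎
    where
    open ≤-Reasoning
    s<k+1+l : s < suc k + l
    s<k+1+l = s≤s (≤-trans (∣m-n∣≤o⇒m≤n+o dist) (m≤n+m l k))

  -- The top point m + d needs a seed in [m + l, m + d + l], which lies beyond the
  -- window [0, m + l) holding every seed that serves a point below m.
  step : ∀ m → P m → P (m + suc d)
  step m ih dom with dom (m + d) (+-monoʳ-< m (n<1+n d))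
  ... | s , es , dist = begin
    ceilDivSuc (m + suc d) d   ≡⟨ ceilDivSuc-+ m d ⟩
    suc (ceilDivSuc m d)       ≡⟨ +-comm 1 _ ⟩
    ceilDivSuc m d + 1         ≤⟨ +-mono-≤ (ih (λ i i<m → dom i (m≤n⇒m≤n+o (suc d) i<m))) es ⟩
    sumBelow (m + l) e + e s   ≤⟨ sumBelow-+term-≤ e m+l≤s s<m+1+d+l ⟩
    sumBelow (m + suc d + l) e ∎
    where
    open ≤-Reasoning
    m+d≡m+l+l : m + d ≡ m + l + l
    m+d≡m+l+l = trans (cong (m +_) (2*m≡m+m l)) (sym (+-assoc m l l))
    m+l≤s : m + l ≤ s
    m+l≤s = ∣m-[n+o]∣≤o⇒n≤m (subst (λ x → ∣ s - x ∣ ≤ l) m+d≡m+l+l dist)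
    s<m+1+d+l : s < m + suc d + l
    s<m+1+d+l = ≤-<-trans (∣m-n∣≤o⇒m≤n+o dist) (+-monoˡ-< l (+-monoʳ-< m (n<1+n d)))

placeAbove : ℕ → (ℕ → Bool) → ℕ → ℕ → Bool
placeAbove m f s i = if i <ᵇ m then f i else (i ≡ᵇ s)

placeAbove-below : ∀ {m} f {s i} → i < m → placeAbove m f s i ≡ f i
placeAbove-below f i<m rewrite T⇒≡true (<⇒<ᵇ i<m) = refl

placeAbove-shift : ∀ m f {l} j → placeAbove m f (m + l) (m + j) ≡ (j ≡ᵇ l)
placeAbove-shift zero    f j = refl
placeAbove-shift (suc m) f j = placeAbove-shift m (f ∘ suc) j

DominatingPattern : ℕ → ℕ → ℕ → Set
DominatingPattern l m c = Σ (ℕ → Bool) λ f →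
  Dominates l (λ s → s < m × f s ≡ true) m × sumBelow m (λ i → indicator (f i)) ≡ c

singleSeedPattern : ∀ {l k} s → s ≤ k →
  (∀ i → i ≤ k → ∣ s - i ∣ ≤ l) → DominatingPattern l (suc k) 1
singleSeedPattern s s≤k near =
  (_≡ᵇ s) ,
  (λ i i≤k → s , (s≤s s≤k , ≡ᵇ-refl s) , near i (s≤s⁻¹ i≤k)) ,
  sumBelow-indicator-≡ᵇ s _ (s≤s s≤k)

optimalPattern : ∀ l m → DominatingPattern l m (ceilDivSuc m (2 * l))
optimalPattern l = blockInduction (λ m → DominatingPattern l m (ceilDivSuc m d)) d base step
  where
  d = 2 * l

  l≤d : l ≤ d
  l≤d = m≤m+n l _

  base : ∀ m → m ≤ d → DominatingPattern l m (ceilDivSuc m d)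
  base zero    _   = (λ _ → false) , (λ _ ()) , sym (ceilDivSuc-zero d)
  base (suc k) k<d =
    subst (DominatingPattern l (suc k)) (sym (ceilDivSuc-small (<⇒≤ k<d))) (centre (k ≤? l))
    where
    centre : Dec (k ≤ l) → DominatingPattern l (suc k) 1
    centre (yes k≤l) = singleSeedPattern k ≤-refl λ i i≤k →
                         ≤-trans (∣m-n∣≤m k i (≤-trans i≤k (m≤m+n k _))) k≤l
    centre (no k≰l)  = singleSeedPattern l (<⇒≤ (≰⇒> k≰l)) λ i i≤k →
                         ∣m-n∣≤m l i (≤-trans i≤k (<⇒≤ k<d))

  step : ∀ m → DominatingPattern l m (ceilDivSuc m d) →
    DominatingPattern l (m + suc d) (ceilDivSuc (m + suc d) d)
  step m (f , dom , count) = F , domF , countF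
    where
    F : ℕ → Bool
    F = placeAbove m f (m + l)

    domF : Dominates l (λ s → s < m + suc d × F s ≡ true) (m + suc d)
    domF i i<end with i <? m
    ... | yes i<m with dom i i<m
    ...   | s , (s<m , fs) , dist =
      s , (<-≤-trans s<m (m≤m+n m _) , trans (placeAbove-below f s<m) fs) , dist
    domF i i<end | no i≮m =
      m + l , (+-monoʳ-< m (s≤s l≤d) , trans (placeAbove-shift m f l) (≡ᵇ-refl l)) , (begin
        ∣ m + l - i ∣           ≡⟨ cong (λ x → ∣ m + l - x ∣) (m+[n∸m]≡n (≮⇒≥ i≮m)) ⟨
        ∣ m + l - m + (i ∸ m) ∣ ≡⟨ ∣m+n-m+o∣≡∣n-o∣ m l (i ∸ m) ⟩
        ∣ l - (i ∸ m) ∣         ≤⟨ ∣m-n∣≤m l (i ∸ m) (s≤s⁻¹ (m<n+o⇒m∸n<o i m i<end)) ⟩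
        l                       ∎)
      where open ≤-Reasoning

    countF : sumBelow (m + suc d) (λ i → indicator (F i)) ≡ ceilDivSuc (m + suc d) d
    countF = begin
      sumBelow (m + suc d) (λ i → indicator (F i))
        ≡⟨ sumBelow-+ m (suc d) _ ⟩
      sumBelow m (λ i → indicator (F i)) + sumBelow (suc d) (λ j → indicator (F (m + j)))
        ≡⟨ cong₂ _+_ (sumBelow-cong m λ i i<m → cong indicator (placeAbove-below f i<m))
                     (sumBelow-cong (suc d) λ j _ → cong indicator (placeAbove-shift m f j)) ⟩
      sumBelow m (λ i → indicator (f i)) + sumBelow (suc d) (λ j → indicator (j ≡ᵇ l))
        ≡⟨ cong₂ _+_ count (sumBelow-indicator-≡ᵇ l (suc d) (s≤s l≤d)) ⟩
      ceilDivSuc m d + 1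
        ≡⟨ +-comm _ 1 ⟩
      suc (ceilDivSuc m d)
        ≡⟨ ceilDivSuc-+ m d ⟨
      ceilDivSuc (m + suc d) d
        ∎
      where open ≡-Reasoning

-- From incentive functions to weights on ℕ

cost-∘toℕ : ∀ n (g : ℕ → ℕ) → cost (λ (v : Fin n) → g (toℕ v)) ≡ sumBelow n g
cost-∘toℕ zero    g = refl
cost-∘toℕ (suc n) g = begin
  g 0 + sum (map (g ∘ toℕ) (tabulate {n = n} fsuc))
    ≡⟨ cong (λ xs → g 0 + sum xs)
            (trans (map-tabulate {n = n} fsuc (g ∘ toℕ))
                   (sym (map-tabulate {n = n} (λ v → v) (g ∘ suc ∘ toℕ)))) ⟩
  g 0 + cost (λ (v : Fin n) → g (suc (toℕ v)))
    ≡⟨ cong (g 0 +_) (cost-∘toℕ n (g ∘ suc)) ⟩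
  g 0 + sumBelow n (g ∘ suc)
    ≡⟨ sumBelow-+ 1 n g ⟨
  sumBelow (suc n) g
    ∎
  where open ≡-Reasoning

extendByZero : ∀ {n} → (Fin n → ℕ) → ℕ → ℕ
extendByZero {zero}  g i       = 0
extendByZero {suc n} g zero    = g fzero
extendByZero {suc n} g (suc i) = extendByZero (g ∘ fsuc) i

extendByZero-toℕ : ∀ {n} (g : Fin n → ℕ) v → extendByZero g (toℕ v) ≡ g v
extendByZero-toℕ g fzero    = refl
extendByZero-toℕ g (fsuc v) = extendByZero-toℕ (g ∘ fsuc) v

extendByZero-≥ : ∀ {n} (g : Fin n → ℕ) i → n ≤ i → extendByZero g i ≡ 0
extendByZero-≥ {zero}  g i       _       = refl
extendByZero-≥ {suc n} g (suc i) (s≤s h) = extendByZero-≥ (g ∘ fsuc) i h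

cost-extendByZero : ∀ {n} (g : Fin n → ℕ) l → cost g ≡ sumBelow (n + l) (extendByZero g)
cost-extendByZero {n} g l = begin
  cost g
    ≡⟨ cong sum (map-cong (λ v → sym (extendByZero-toℕ g v)) (allFin n)) ⟩
  cost (λ (v : Fin n) → extendByZero g (toℕ v))
    ≡⟨ cost-∘toℕ n (extendByZero g) ⟩
  sumBelow n (extendByZero g)
    ≡⟨ +-identityʳ _ ⟨
  sumBelow n (extendByZero g) + 0
    ≡⟨ cong (sumBelow n (extendByZero g) +_)
            (sumBelow-zero l (λ j _ → extendByZero-≥ g (n + j) (m≤m+n n j))) ⟨
  sumBelow n (extendByZero g) + sumBelow l (λ j → extendByZero g (n + j))
    ≡⟨ sumBelow-+ n l (extendByZero g) ⟨
  sumBelow (n + l) (extendByZero g)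
    ∎
  where open ≡-Reasoning

pattern⇒solution : ∀ {l n c} → DominatingPattern l n c →
  Σ (Fin n → ℕ) λ p → IsSolution (path n) (λ _ → 1) l p × cost p ≡ c
pattern⇒solution {l} {n} (f , dom , count) =
  p , ((λ v → indicator≤1 (f (toℕ v))) , influenced) , trans (cost-∘toℕ n _) count
  where
  p : Fin n → ℕ
  p v = indicator (f (toℕ v))

  influenced : ∀ v → Influenced (path n) (λ _ → 1) p l v ≡ true
  influenced v with dom (toℕ v) (toℕ<n v)
  ... | s , (s<n , fs) , dist = seed-within⇒influenced p
    (trans (cong (λ x → indicator (f x)) (toℕ-fromℕ< s<n)) (cong indicator fs))
    (subst (λ x → ∣ x - toℕ v ∣ ≤ l) (sym (toℕ-fromℕ< s<n)) dist)

solution⇒dominates : ∀ {l n} {q : Fin n → ℕ} → IsSolution (path n) (λ _ → 1) l q →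
  Dominates l (λ s → 1 ≤ extendByZero q s) n
solution⇒dominates {l} {q = q} (q≤1 , influenced) i i<n
  with influenced⇒seed-within q q≤1 l (fromℕ< i<n) (influenced (fromℕ< i<n))
... | u , qu , dist =
  toℕ u , ≤-reflexive (sym (trans (extendByZero-toℕ q u) qu)) ,
  subst (λ x → ∣ toℕ u - x ∣ ≤ l) (toℕ-fromℕ< i<n) dist

lemma5 : (λ' n : ℕ) → λ' ≥ 1 → n ≥ 1 →
    IsMinCost (path n) (λ _ → 1) λ' (ceilDivSuc n (2 * λ'))
lemma5 l n _ _ = pattern⇒solution (optimalPattern l n) , λ q solution → begin
  ceilDivSuc n (2 * l)
    ≤⟨ ceilDivSuc≤dominating-weight l (extendByZero q) n (solution⇒dominates solution) ⟩
  sumBelow (n + l) (extendByZero q)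
    ≡⟨ cost-extendByZero q l ⟨
  cost q
    ∎
  where open ≤-Reasoning
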